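{- Let $p$ be a prime and $G$ a nontrivial finite abelian $p$-group of exponent $p^e$. As $n$ runs over positive integers with $p^e\nmid(n-1)$, the rational numbers \[ \frac{1+\sum_{i\ge1}\left(\left\lfloor \frac{n-1}{p^{i-1}}\right\rfloor -\left\lfloor \frac{n-1}{p^{i}}\right\rfloor \right)r_i(G)}{n-1} \] attain a maximum, and this maximum is attained only for $n=2$.
   Context: For $i\ge1$, the $p^i$-rank of $G$ is $r_i(G):=\log_p(p^{i-1}G:p^iG)$. -}

module Defs where

open import Level using (Level)
open import Data.Bool using (Bool; true; false; if_then_else_)
open import Data.Nat using (ℕ; zero; suc; _+_; _*_; _∸_; _^_; _≤ᵇ_)
import Data.Nat.DivMod as NDM
open import Data.Integer using (+_)
open import Data.Rational using (ℚ; 0ℚ) renaming (_/_ to _÷_)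
open import Data.List using (List; length; filter)
open import Data.List.Relation.Unary.Any using (Any; any?)
open import Data.List.Relation.Unary.All using (All)
open import Data.List.Relation.Unary.AllPairs using (AllPairs)
open import Data.Product using (Σ; ∃; _×_)
open import Relation.Nullary using (Dec; ¬_)
open import Algebra.Bundles using (AbelianGroup)

-- floor division with the junk convention  m / 0 = 0
divFloor : ℕ → ℕ → ℕ
divFloor m zero    = zero
divFloor m (suc d) = NDM._/_ m (suc d)

-- floor logarithm: largest k ≤ x with b ^ k ≤ x (0 if none);
-- for b ≥ 2 this is ⌊log_b x⌋, exact on powers of b.
flogAux : ℕ → ℕ → ℕ → ℕ
flogAux b x zero    = zero
flogAux b x (suc k) = if b ^ suc k ≤ᵇ x then suc k else flogAux b x k

logBase : ℕ → ℕ → ℕ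
logBase b x = flogAux b x x

record FiniteAbelianGroup (c ℓ : Level) : Set (Level.suc (c Level.⊔ ℓ)) where
  field
    abGroup : AbelianGroup c ℓ
  open AbelianGroup abGroup public
  field
    _≈?_     : (x y : Carrier) → Dec (x ≈ y)
    elems    : List Carrier
    complete : (x : Carrier) → Any (x ≈_) elems
    distinct : AllPairs (λ x y → ¬ (x ≈ y)) elems

  mul : ℕ → Carrier → Carrier
  mul zero    g = ε
  mul (suc n) g = g ∙ mul n g

  -- |mG|, the cardinality of the subgroup mG = { m·g | g ∈ G }
  cardMul : ℕ → ℕ
  cardMul m = length (filter (λ x → any? (λ g → x ≈? mul m g) elems) elems)

  card : ℕ
  card = length elems


module _ {c ℓ : Level} (G : FiniteAbelianGroup c ℓ) where
  open FiniteAbelianGroup G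

  index : ℕ → ℕ → ℕ
  index p i = divFloor (cardMul (p ^ (i ∸ 1))) (cardMul (p ^ i))

  -- p^i-rank  r_i(G) = log_p (p^(i-1) G : p^i G)
  rank : ℕ → ℕ → ℕ
  rank p i = logBase p (index p i)

  HasExponent : ℕ → ℕ → Set (c Level.⊔ ℓ)
  HasExponent p e = ((g : Carrier) → mul (p ^ e) g ≈ ε)
                  × (Σ Carrier λ g → ¬ (mul (p ^ (e ∸ 1)) g ≈ ε))

  Nontrivial : Set (c Level.⊔ ℓ)
  Nontrivial = Σ Carrier λ g → ¬ (g ≈ ε)

  -- numerator  1 + Σ_{i=1}^{e} (⌊m/p^(i-1)⌋ - ⌊m/p^i⌋) r_i(G)
  -- (terms with i > e vanish since r_i(G) = 0 there)
  sumTerms : ℕ → ℕ → ℕ → ℕ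
  sumTerms p m zero    = zero
  sumTerms p m (suc i) = sumTerms p m i
    + (divFloor m (p ^ i) ∸ divFloor m (p ^ suc i)) * rank p (suc i)

  -- the rational number  (1 + Σ ...) / (n - 1);  junk value 0 when n - 1 = 0
  ratio : ℕ → ℕ → ℕ → ℚ
  ratio p e n with n ∸ 1
  ... | zero  = 0ℚ
  ... | suc m = (+ (1 + sumTerms p (suc m) e)) ÷ suc m

{-# OPTIONS --safe #-}
module Submission where

-- Since multiplication by k maps G/jG onto kG/kjG, (kG : kjG) ≤ (G : jG); concretely,
-- |jG| = |kjG| · |jG ∩ G[k]| by double counting, and jG ∩ G[k] ⊆ G[k]. Taking j = p and
-- k = p^(i-1) gives r_i(G) ≤ r_1(G) for every i, so the numerator telescopes to at most
-- 1 + r_1(G)(n-1). At n = 2 it is exactly 1 + r_1(G), hence the quotient equals 1 + r_1(G)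
-- there and is strictly smaller for every n ≥ 3.

open import Defs
open import Level using (Level; _⊔_)
open import Data.Bool using (true; false; T)
open import Data.Empty using (⊥-elim)
import Data.Integer as ℤ
open import Data.Integer.Properties as ℤ using (pos-*)
open import Data.Fin using (Fin)
open import Data.List using (List; []; _∷_; length; filter; lookup)
open import Data.List.Properties using (filter-none; filter-some; filter-≐)
open import Data.List.Relation.Binary.Sublist.Propositional using (⊆-refl)
open import Data.List.Relation.Binary.Sublist.Propositional.Properties using (filter⁺; length-mono-≤)
import Data.List.Relation.Unary.All as All
open import Data.List.Relation.Unary.Any as Any using (Any; here; there; any?)
open import Data.List.Relation.Unary.AllPairs using (AllPairs; _∷_)
open import Data.Nat as ℕ using (ℕ; zero; suc; _+_; _*_; _∸_; _^_; _≤_; _≤′_; _≤ᵇ_; NonZero; s≤s; z≤n)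
open import Data.Nat.DivMod using (_/_; /-monoˡ-≤; /-monoʳ-≤; m*n/n≡m; m/n*n≤m; n/1≡n; m<n⇒m/n≡0)
open import Data.Nat.Divisibility using (_∣_; ∣1⇒≡1; _∣0)
open import Data.Nat.Primality using (Prime; ¬prime[0]; ¬prime[1])
open import Data.Nat.Properties
open import Data.Product using (_×_; _,_; proj₁; proj₂)
open import Data.Rational using (_<_)
import Data.Rational as ℚ
import Data.Rational.Properties as ℚ
import Data.Rational.Unnormalised as ℚᵘ
import Data.Rational.Unnormalised.Properties as ℚᵘ
open import Data.Unit using (tt)
open import Function using (_∘_; id)
open import Relation.Binary using (Setoid; _Respects_)
import Relation.Binary.Definitions as B
open import Relation.Binary.PropositionalEquality as ≡ using (_≡_; _≢_)
open import Relation.Nullary using (Dec; yes; no; ¬_; _×-dec_)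
open import Relation.Unary using (Pred; Decidable; _⊆_; _≐_)
open import Algebra.Properties.Semiring.Sum +-*-semiring
  using (sum-syntax; sum-cong-≗; ∑-comm; *-distribʳ-sum)

χ : ∀ {a} {A : Set a} → Dec A → ℕ
χ (yes _) = 1
χ (no _)  = 0

length-filter≡∑χ : ∀ {a p} {A : Set a} {P : Pred A p} (P? : Decidable P) (xs : List A) →
                   length (filter P? xs) ≡ ∑[ i < length xs ] χ (P? (lookup xs i))
length-filter≡∑χ P? []       = ≡.refl
length-filter≡∑χ P? (x ∷ xs) with P? x
... | yes _ = ≡.cong suc (length-filter≡∑χ P? xs)
... | no _  = length-filter≡∑χ P? xs

module Counting {c ℓ} (S : Setoid c ℓ)
  (_≈?_ : B.Decidable (Setoid._≈_ S)) (elems : List (Setoid.Carrier S))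
  (complete : ∀ x → Any (Setoid._≈_ S x) elems)
  (distinct : AllPairs (λ x y → ¬ Setoid._≈_ S x y) elems) where
  open Setoid S

  count : ∀ {p} {P : Pred Carrier p} → Decidable P → ℕ
  count P? = length (filter P? elems)

  module _ {p q} {P : Pred Carrier p} {Q : Pred Carrier q} (P? : Decidable P) (Q? : Decidable Q) where

    count-cong : P ≐ Q → count P? ≡ count Q?
    count-cong P≐Q = ≡.cong length (filter-≐ P? Q? P≐Q elems)

    count-mono : P ⊆ Q → count P? ≤ count Q?
    count-mono P⊆Q = length-mono-≤ (filter⁺ P? Q? (λ { ≡.refl → P⊆Q }) (⊆-refl {x = elems}))

  count-empty : ∀ {p} {P : Pred Carrier p} (P? : Decidable P) → (∀ {x} → ¬ P x) → count P? ≡ 0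
  count-empty P? ¬P = ≡.cong length (filter-none P? {xs = elems} (All.tabulate (λ _ → ¬P)))

  count-pos : ∀ {p} {P : Pred Carrier p} (P? : Decidable P) → P Respects _≈_ → ∀ {x} → P x → 1 ≤ count P?
  count-pos P? resp Px = filter-some P? {xs = elems} (Any.map (λ x≈y → resp x≈y Px) (complete _))

  occurs-once : ∀ {x xs} → AllPairs (λ x y → ¬ x ≈ y) xs → Any (x ≈_) xs → length (filter (x ≈?_) xs) ≡ 1
  occurs-once {x} {y ∷ ys} (y≉ys ∷ _) _ with x ≈? y
  ... | yes x≈y = ≡.cong (suc ∘ length)
    (filter-none (x ≈?_) (All.map (λ y≉z x≈z → y≉z (trans (sym x≈y) x≈z)) y≉ys))
  occurs-once {x} {y ∷ ys} _              (here x≈y) | no x≉y = ⊥-elim (x≉y x≈y)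
  occurs-once {x} {y ∷ ys} (_ ∷ distinct′) (there x∈) | no _   = occurs-once distinct′ x∈

  count-≈ : ∀ x → count (x ≈?_) ≡ 1
  count-≈ x = occurs-once distinct (complete x)

  count≡∑χ : ∀ {p} {P : Pred Carrier p} (P? : Decidable P) →
             count P? ≡ ∑[ i < length elems ] χ (P? (lookup elems i))
  count≡∑χ P? = length-filter≡∑χ P? elems

  count-fibres : ∀ {a b} {A : Pred Carrier a} {B : Pred Carrier b} (A? : Decidable A) (B? : Decidable B)
    (φ : Carrier → Carrier) → B Respects _≈_ → (∀ {x} → A x → B (φ x)) →
    ∀ κ → (∀ {y} → B y → count (λ x → A? x ×-dec φ x ≈? y) ≡ κ) →
    count A? ≡ count B? * κ
  count-fibres A? B? φ B-resp A⇒Bφ κ fibre = begin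
    count A?
      ≡⟨ count≡∑χ A? ⟩
    ∑[ i < N ] χ (A? (e i))
      ≡⟨ sum-cong-≗ {N} (λ i → count-image (e i)) ⟨
    ∑[ i < N ] count (λ y → A? (e i) ×-dec φ (e i) ≈? y)
      ≡⟨ sum-cong-≗ {N} (λ i → count≡∑χ _) ⟩
    ∑[ i < N ] ∑[ j < N ] χ (A? (e i) ×-dec φ (e i) ≈? e j)
      ≡⟨ ∑-comm (λ i j → χ (A? (e i) ×-dec φ (e i) ≈? e j)) ⟩
    ∑[ j < N ] ∑[ i < N ] χ (A? (e i) ×-dec φ (e i) ≈? e j)
      ≡⟨ sum-cong-≗ {N} (λ j → count≡∑χ _) ⟨
    ∑[ j < N ] count (λ x → A? x ×-dec φ x ≈? e j)
      ≡⟨ sum-cong-≗ {N} (λ j → count-fibre (e j)) ⟩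
    ∑[ j < N ] (χ (B? (e j)) * κ)
      ≡⟨ *-distribʳ-sum κ (χ ∘ B? ∘ e) ⟨
    (∑[ j < N ] χ (B? (e j))) * κ
      ≡⟨ ≡.cong (_* κ) (count≡∑χ B?) ⟨
    count B? * κ
      ∎
    where
    open ≡.≡-Reasoning
    N : ℕ
    N = length elems
    e : Fin N → Carrier
    e = lookup elems
    count-image : ∀ x → count (λ y → A? x ×-dec φ x ≈? y) ≡ χ (A? x)
    count-image x with A? x
    ... | yes Ax = ≡.trans (count-cong _ _ (proj₂ , (Ax ,_))) (count-≈ (φ x))
    ... | no ¬Ax = count-empty _ (¬Ax ∘ proj₁)
    count-fibre : ∀ y → count (λ x → A? x ×-dec φ x ≈? y) ≡ χ (B? y) * κ
    count-fibre y with B? y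
    ... | yes By = ≡.trans (fibre By) (≡.sym (+-identityʳ κ))
    ... | no ¬By = count-empty _ (λ (Ax , φx≈y) → ¬By (B-resp φx≈y (A⇒Bφ Ax)))

module _ {c ℓ : Level} (G : FiniteAbelianGroup c ℓ) where
  open FiniteAbelianGroup G
  open import Algebra.Properties.AbelianGroup abGroup
    using (x≈z//y; //-rightDividesʳ; //-rightDividesˡ; identityˡ-unique; inverseʳ-unique)
  open import Algebra.Properties.CommutativeSemigroup commutativeSemigroup using (interchange)
  open Counting setoid _≈?_ elems complete distinct

  mul-cong : ∀ n {x y} → x ≈ y → mul n x ≈ mul n y
  mul-cong zero    x≈y = refl
  mul-cong (suc n) x≈y = ∙-cong x≈y (mul-cong n x≈y)

  mul-ε : ∀ n → mul n ε ≈ ε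
  mul-ε zero    = refl
  mul-ε (suc n) = trans (identityˡ _) (mul-ε n)

  mul-+ : ∀ m n g → mul (m + n) g ≈ mul m g ∙ mul n g
  mul-+ zero    n g = sym (identityˡ _)
  mul-+ (suc m) n g = trans (∙-congˡ (mul-+ m n g)) (sym (assoc _ _ _))

  mul-* : ∀ m n g → mul (m * n) g ≈ mul m (mul n g)
  mul-* zero    n g = refl
  mul-* (suc m) n g = trans (mul-+ n (m * n) g) (∙-congˡ (mul-* m n g))

  mul-∙ : ∀ n g h → mul n (g ∙ h) ≈ mul n g ∙ mul n h
  mul-∙ zero    g h = sym (identityˡ _)
  mul-∙ (suc n) g h = trans (∙-congˡ (mul-∙ n g h)) (interchange _ _ _ _)

  mul-⁻¹ : ∀ n g → mul n (g ⁻¹) ≈ mul n g ⁻¹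
  mul-⁻¹ n g = inverseʳ-unique _ _
    (trans (sym (mul-∙ n g (g ⁻¹))) (trans (mul-cong n (inverseʳ g)) (mul-ε n)))

  -- x ∈ mG, with the witness taken from the enumeration so that cardMul m counts exactly these x.
  Multiple : ℕ → Pred Carrier (c ⊔ ℓ)
  Multiple m x = Any (λ g → x ≈ mul m g) elems

  multiple? : ∀ m → Decidable (Multiple m)
  multiple? m x = any? (λ g → x ≈? mul m g) elems

  multiple-resp : ∀ m → Multiple m Respects _≈_
  multiple-resp m x≈y = Any.map (trans (sym x≈y))

  mul-multiple : ∀ m g → Multiple m (mul m g)
  mul-multiple m g = Any.map (mul-cong m) (complete g)

  ε-multiple : ∀ m → Multiple m ε
  ε-multiple m = multiple-resp m (mul-ε m) (mul-multiple m ε)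

  multiple-1 : ∀ x → Multiple 1 x
  multiple-1 x = multiple-resp 1 (identityʳ x) (mul-multiple 1 x)

  multiple-∙ : ∀ m {x y} → Multiple m x → Multiple m y → Multiple m (x ∙ y)
  multiple-∙ m x∈ y∈ with Any.satisfied x∈ | Any.satisfied y∈
  ... | g , x≈ | h , y≈ =
    multiple-resp m (trans (mul-∙ m g h) (sym (∙-cong x≈ y≈))) (mul-multiple m (g ∙ h))

  multiple-⁻¹ : ∀ m {x} → Multiple m x → Multiple m (x ⁻¹)
  multiple-⁻¹ m x∈ with Any.satisfied x∈
  ... | g , x≈ = multiple-resp m (trans (mul-⁻¹ m g) (⁻¹-cong (sym x≈))) (mul-multiple m (g ⁻¹))

  multiple-mul : ∀ j k {x} → Multiple j x → Multiple (k * j) (mul k x)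
  multiple-mul j k x∈ with Any.satisfied x∈
  ... | g , x≈ =
    multiple-resp (k * j) (trans (mul-* k j g) (mul-cong k (sym x≈))) (mul-multiple (k * j) g)

  count-translate : ∀ {q} {Q : Pred Carrier q} (Q? : Decidable Q) → Q Respects _≈_ →
                    ∀ a → count (λ z → Q? (z ∙ a)) ≡ count Q?
  count-translate {Q = Q} Q? Q-resp a =
    ≡.trans (count-fibres (Q? ∘ (_∙ a)) Q? (_∙ a) Q-resp id 1 fibre) (*-identityʳ _)
    where
    fibre : ∀ {y} → Q y → count (λ z → Q? (z ∙ a) ×-dec (z ∙ a) ≈? y) ≡ 1
    fibre {y} Qy = ≡.trans (count-cong _ _ (to , from)) (count-≈ (y ∙ a ⁻¹))
      where
      to : ∀ {z} → Q (z ∙ a) × z ∙ a ≈ y → y ∙ a ⁻¹ ≈ z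
      to {z} (_ , za≈y) = sym (x≈z//y z a y za≈y)
      from : ∀ {z} → y ∙ a ⁻¹ ≈ z → Q (z ∙ a) × z ∙ a ≈ y
      from {z} y/a≈z = Q-resp (sym za≈y) Qy , za≈y
        where
        za≈y : z ∙ a ≈ y
        za≈y = trans (∙-congʳ (sym y/a≈z)) (//-rightDividesˡ a y)

  Over : ℕ → ℕ → Carrier → Pred Carrier (c ⊔ ℓ)
  Over j k y x = Multiple j x × mul k x ≈ y

  over? : ∀ j k y → Decidable (Over j k y)
  over? j k y x = multiple? j x ×-dec mul k x ≈? y

  over-resp : ∀ j k y → Over j k y Respects _≈_
  over-resp j k y x≈x′ (x∈ , kx≈y) = multiple-resp j x≈x′ x∈ , trans (mul-cong k (sym x≈x′)) kx≈y

  kerCard : ℕ → ℕ → ℕ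
  kerCard j k = count (over? j k ε)

  fibre-card : ∀ j k {y} → Multiple (k * j) y → count (over? j k y) ≡ kerCard j k
  fibre-card j k {y} y∈ with Any.satisfied y∈
  ... | g , y≈ =
    ≡.trans (≡.sym (count-translate (over? j k y) (over-resp j k y) a)) (count-cong _ _ (to , from))
    where
    a : Carrier
    a = mul j g
    ka≈y : mul k a ≈ y
    ka≈y = sym (trans y≈ (mul-* k j g))
    to : ∀ {z} → Over j k y (z ∙ a) → Over j k ε z
    to {z} (za∈ , kza≈y) =
      multiple-resp j (//-rightDividesʳ a z) (multiple-∙ j za∈ (multiple-⁻¹ j (mul-multiple j g))) ,
      identityˡ-unique _ _ (trans (sym (mul-∙ k z a)) (trans kza≈y (sym ka≈y)))
    from : ∀ {z} → Over j k ε z → Over j k y (z ∙ a)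
    from {z} (z∈ , kz≈ε) =
      multiple-∙ j z∈ (mul-multiple j g) ,
      trans (mul-∙ k z a) (trans (∙-congʳ kz≈ε) (trans (identityˡ _) ka≈y))

  cardMul≡cardMul*kerCard : ∀ j k → cardMul j ≡ cardMul (k * j) * kerCard j k
  cardMul≡cardMul*kerCard j k = count-fibres (multiple? j) (multiple? (k * j)) (mul k)
    (multiple-resp (k * j)) (multiple-mul j k) (kerCard j k) (fibre-card j k)

  cardMul-pos : ∀ m → 1 ≤ cardMul m
  cardMul-pos m = count-pos (multiple? m) (multiple-resp m) (ε-multiple m)

  kerCard-pos : ∀ j k → 1 ≤ kerCard j k
  kerCard-pos j k = count-pos (over? j k ε) (over-resp j k ε) (ε-multiple j , mul-ε k)

  kerCard-≤ : ∀ j k → kerCard j k ≤ kerCard 1 k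
  kerCard-≤ j k = count-mono (over? j k ε) (over? 1 k ε) (λ (_ , kz≈ε) → multiple-1 _ , kz≈ε)

divFloor-≤-*-* : ∀ m n {a b} → 1 ≤ n → 1 ≤ a → a ≤ b → divFloor m n ≤ divFloor (m * b) (n * a)
divFloor-≤-*-* m (suc n-1) {suc a-1} {b} _ _ a≤b =
  ≡.subst (_≤ (m * b) / (n * a)) (m*n/n≡m (m / n) (n * a)) (/-monoˡ-≤ (n * a) m/n*na≤mb)
  where
  n a : ℕ
  n = suc n-1
  a = suc a-1
  m/n*na≤mb : m / n * (n * a) ≤ m * b
  m/n*na≤mb = begin
    m / n * (n * a) ≡⟨ *-assoc (m / n) n a ⟨
    m / n * n * a   ≤⟨ *-monoˡ-≤ a (m/n*n≤m m n) ⟩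
    m * a           ≤⟨ *-monoʳ-≤ m a≤b ⟩
    m * b           ∎
    where open ≤-Reasoning

divFloor-antitoneʳ : ∀ m {a b} → 1 ≤ a → a ≤ b → divFloor m b ≤ divFloor m a
divFloor-antitoneʳ m {suc _} {suc _} _ a≤b = /-monoʳ-≤ m a≤b

flogAux-≤ : ∀ b x k → flogAux b x k ≤ k
flogAux-≤ b x zero    = z≤n
flogAux-≤ b x (suc k) with b ^ suc k ≤ᵇ x
... | true  = ≤-refl
... | false = m≤n⇒m≤1+n (flogAux-≤ b x k)

flogAux-monoˡ : ∀ b k {x y} → x ≤ y → flogAux b x k ≤ flogAux b y k
flogAux-monoˡ b zero    x≤y = z≤n
flogAux-monoˡ b (suc k) {x} {y} x≤y with b ^ suc k ≤ᵇ x in bᵏ⁺¹≤x | b ^ suc k ≤ᵇ y in bᵏ⁺¹≤y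
... | true  | true  = ≤-refl
... | false | true  = m≤n⇒m≤1+n (flogAux-≤ b x k)
... | false | false = flogAux-monoˡ b k x≤y
... | true  | false =
  ⊥-elim (≡.subst T bᵏ⁺¹≤y (≤⇒≤ᵇ (≤-trans (≤ᵇ⇒≤ (b ^ suc k) x (≡.subst T (≡.sym bᵏ⁺¹≤x) tt)) x≤y)))

flogAux-≤-suc : ∀ b x k → flogAux b x k ≤ flogAux b x (suc k)
flogAux-≤-suc b x k with b ^ suc k ≤ᵇ x
... | true  = m≤n⇒m≤1+n (flogAux-≤ b x k)
... | false = ≤-refl

flogAux-monoʳ : ∀ b x {k k′} → k ≤′ k′ → flogAux b x k ≤ flogAux b x k′
flogAux-monoʳ b x ℕ.≤′-refl        = ≤-refl
flogAux-monoʳ b x (ℕ.≤′-step k≤k′) = ≤-trans (flogAux-monoʳ b x k≤k′) (flogAux-≤-suc b x _)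

logBase-mono : ∀ b {x y} → x ≤ y → logBase b x ≤ logBase b y
logBase-mono b {x} {y} x≤y = ≤-trans (flogAux-monoˡ b x x≤y) (flogAux-monoʳ b y (≤⇒≤′ x≤y))

module _ {c ℓ : Level} (G : FiniteAbelianGroup c ℓ) where
  open FiniteAbelianGroup G using (cardMul)

  index-kG-kjG≤index-G-jG : ∀ j k →
                            divFloor (cardMul k) (cardMul (k * j)) ≤ divFloor (cardMul 1) (cardMul j)
  index-kG-kjG≤index-G-jG j k =
    ≡.subst₂ (λ s t → divFloor (cardMul k) (cardMul (k * j)) ≤ divFloor s t)
    (≡.sym |G|≡) (≡.sym (cardMul≡cardMul*kerCard G j k))
    (divFloor-≤-*-* _ _ (cardMul-pos G (k * j)) (kerCard-pos G j k) (kerCard-≤ G j k))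
    where
    |G|≡ : cardMul 1 ≡ cardMul k * kerCard G 1 k
    |G|≡ = ≡.trans (cardMul≡cardMul*kerCard G 1 k)
                   (≡.cong (λ m → cardMul m * kerCard G 1 k) (*-identityʳ k))

  rank-≤-rank₁ : ∀ p i → rank G p (suc i) ≤ rank G p 1
  rank-≤-rank₁ p i = logBase-mono p
    (≡.subst₂ (λ s t → divFloor (cardMul (p ^ i)) (cardMul s) ≤ divFloor (cardMul 1) (cardMul t))
              (*-comm (p ^ i) p) (≡.sym (*-identityʳ p)) (index-kG-kjG≤index-G-jG p (p ^ i)))

  module _ (p : ℕ) .{{_ : NonZero p}} where
    r₁ : ℕ
    r₁ = rank G p 1

    -- Σ ≤ r₁ (m - ⌊m/pᵉ⌋), with the subtraction moved to the left so that no truncation occurs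
    sumTerms-telescope : ∀ m e → sumTerms G p m e + r₁ * divFloor m (p ^ e) ≤ r₁ * m
    sumTerms-telescope m zero    = ≤-reflexive (≡.cong (r₁ *_) (n/1≡n m))
    sumTerms-telescope m (suc e) = begin
      sumTerms G p m e + (dₑ ∸ dₑ₊₁) * rank G p (suc e) + r₁ * dₑ₊₁
        ≤⟨ +-monoˡ-≤ (r₁ * dₑ₊₁) (+-monoʳ-≤ (sumTerms G p m e) (*-monoʳ-≤ (dₑ ∸ dₑ₊₁) (rank-≤-rank₁ p e))) ⟩
      sumTerms G p m e + (dₑ ∸ dₑ₊₁) * r₁ + r₁ * dₑ₊₁
        ≡⟨ +-assoc (sumTerms G p m e) _ _ ⟩
      sumTerms G p m e + ((dₑ ∸ dₑ₊₁) * r₁ + r₁ * dₑ₊₁)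
        ≡⟨ ≡.cong (sumTerms G p m e +_) r₁*dₑ≡ ⟩
      sumTerms G p m e + r₁ * dₑ
        ≤⟨ sumTerms-telescope m e ⟩
      r₁ * m ∎
      where
      open ≤-Reasoning
      dₑ dₑ₊₁ : ℕ
      dₑ = divFloor m (p ^ e)
      dₑ₊₁ = divFloor m (p ^ suc e)
      dₑ₊₁≤dₑ : dₑ₊₁ ≤ dₑ
      dₑ₊₁≤dₑ = divFloor-antitoneʳ m (m^n>0 p e) (m≤n*m (p ^ e) p)
      r₁*dₑ≡ : (dₑ ∸ dₑ₊₁) * r₁ + r₁ * dₑ₊₁ ≡ r₁ * dₑ
      r₁*dₑ≡ = begin-equality
        (dₑ ∸ dₑ₊₁) * r₁ + r₁ * dₑ₊₁ ≡⟨ ≡.cong (_+ r₁ * dₑ₊₁) (*-comm (dₑ ∸ dₑ₊₁) r₁) ⟩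
        r₁ * (dₑ ∸ dₑ₊₁) + r₁ * dₑ₊₁ ≡⟨ *-distribˡ-+ r₁ (dₑ ∸ dₑ₊₁) dₑ₊₁ ⟨
        r₁ * (dₑ ∸ dₑ₊₁ + dₑ₊₁)      ≡⟨ ≡.cong (r₁ *_) (m∸n+n≡m dₑ₊₁≤dₑ) ⟩
        r₁ * dₑ                      ∎

    sumTerms-≤ : ∀ m e → sumTerms G p m e ≤ r₁ * m
    sumTerms-≤ m e = ≤-trans (m≤m+n _ _) (sumTerms-telescope m e)

  rank₁≤sumTerms-1 : ∀ q e → rank G (2 + q) 1 ≤ sumTerms G (2 + q) 1 (suc e)
  rank₁≤sumTerms-1 q zero    = ≤-reflexive (≡.sym (≡.trans
    (≡.cong (λ t → (1 ∸ t) * rank G (2 + q) 1) (m<n⇒m/n≡0 {1} {(2 + q) * 1} (s≤s (s≤s z≤n))))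
    (*-identityˡ _)))
  rank₁≤sumTerms-1 q (suc e) = ≤-trans (rank₁≤sumTerms-1 q e) (m≤m+n _ _)

+/suc<+/suc : ∀ a b c d → a * suc d ℕ.< c * suc b → (ℤ.+ a) ℚ./ suc b < (ℤ.+ c) ℚ./ suc d
+/suc<+/suc a b c d lt = ℚ.toℚᵘ-cancel-<
  (ℚᵘ.<-respˡ-≃ (ℚᵘ.≃-sym (ℚ.toℚᵘ-fromℚᵘ (ℚᵘ.mkℚᵘ (ℤ.+ a) b)))
  (ℚᵘ.<-respʳ-≃ (ℚᵘ.≃-sym (ℚ.toℚᵘ-fromℚᵘ (ℚᵘ.mkℚᵘ (ℤ.+ c) d)))
  (ℚᵘ.*<* (≡.subst₂ ℤ._<_ (pos-* a (suc d)) (pos-* c (suc b)) (ℤ.+<+ lt)))))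

[1+s]*1<[1+s₁]*m : ∀ r s s₁ m → s ≤ r * m → r ≤ s₁ → 2 ≤ m → (1 + s) * 1 ℕ.< (1 + s₁) * m
[1+s]*1<[1+s₁]*m r s s₁ m s≤rm r≤s₁ 2≤m = begin-strict
  (1 + s) * 1 ≡⟨ *-identityʳ (1 + s) ⟩
  1 + s       ≤⟨ s≤s s≤rm ⟩
  1 + r * m   <⟨ +-monoˡ-< (r * m) 2≤m ⟩
  (1 + r) * m ≤⟨ *-monoˡ-≤ m (s≤s r≤s₁) ⟩
  (1 + s₁) * m ∎
  where open ≤-Reasoning

lemma8p16 : {c ℓ : Level} (p e : ℕ) (G : FiniteAbelianGroup c ℓ)
    → Prime p → Nontrivial G → HasExponent G p e
    → (¬ (p ^ e ∣ 2 ∸ 1))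
      × ((n : ℕ) → 1 ≤ n → ¬ (p ^ e ∣ n ∸ 1) → n ≢ 2
         → ratio G p e n < ratio G p e 2)
lemma8p16 zero             e       _ p-prime _ _ = ⊥-elim (¬prime[0] p-prime)
lemma8p16 (suc zero)       e       _ p-prime _ _ = ⊥-elim (¬prime[1] p-prime)
lemma8p16 (suc (suc q))    zero    _ _ _ (killed , g , g-survives) = ⊥-elim (g-survives (killed g))
lemma8p16 p@(suc (suc q))  (suc e) G _ _ _ = pᵉ⁺¹∤1 , ratio<ratio-2
  where
  pᵉ⁺¹∤1 : ¬ (p ^ suc e ∣ 1)
  pᵉ⁺¹∤1 pᵉ⁺¹∣1 with m*n≡1⇒m≡1 p (p ^ e) (∣1⇒≡1 pᵉ⁺¹∣1)
  ... | ()
  ratio<ratio-2 : (n : ℕ) → 1 ≤ n → ¬ (p ^ suc e ∣ n ∸ 1) → n ≢ 2 →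
                  ratio G p (suc e) n < ratio G p (suc e) 2
  ratio<ratio-2 (suc zero)          _ pᵉ⁺¹∤0 _ = ⊥-elim (pᵉ⁺¹∤0 (_ ∣0))
  ratio<ratio-2 (suc (suc zero))    _ _      n≢2 = ⊥-elim (n≢2 ≡.refl)
  ratio<ratio-2 (suc (suc (suc k))) _ _      _   = +/suc<+/suc (1 + s) (suc k) (1 + s₁) 0
    ([1+s]*1<[1+s₁]*m (rank G p 1) s s₁ m
      (sumTerms-≤ G p m (suc e)) (rank₁≤sumTerms-1 G q e) (s≤s (s≤s z≤n)))
    where
    m s s₁ : ℕ
    m = 2 + k
    s = sumTerms G p m (suc e)
    s₁ = sumTerms G p 1 (suc e)
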